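{- If $\hat u<_{pred}\hat v$, then $child_c(\hat u)<_{pred}child_c(\hat v)$ for every $c\in out(\hat u)\cap out(\hat v)$.
   Context: A trie is a rooted tree with $n$ nodes whose edges are labeled with characters of $\Sigma$, totally ordered by $\prec$, such that the edges leaving any node carry pairwise distinct labels. $\lambda(\hat u)$ is the label of the edge entering $\hat u$ (the root gets $\#$, the smallest character, labeling no edge). $child_c(\hat u)$ is the child of $\hat u$ reached via the edge labeled $c$, and $out(\hat u)$ is the set of labels of edges leaving $\hat u$. Nodes are totally ordered co-lexicographically: $\hat u<\hat v$ iff the root-to-node label string $\lambda(\text{root})\cdots\lambda(\hat u)$ precedes $\lambda(\text{root})\cdots\lambda(\hat v)$ when compared right-to-left with $\prec$. With $\hat u_1<\dots<\hat u_n$ the sorted nodes, $\hat u_i<_{pred}\hat u_j$ means $j=i+1$. -}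

module Defs where

open import Level using (Level; suc; _⊔_)
open import Data.List using (List; []; _∷_; _++_; [_]; reverse)
open import Data.List.Membership.Propositional using (_∈_; _∉_)
open import Data.List.Relation.Unary.Unique.Propositional using (Unique)
open import Data.List.Relation.Binary.Lex.Strict using (Lex-<)
open import Data.Product using (Σ; _×_; ∃)
open import Relation.Binary.Core using (Rel)
open import Relation.Binary.Structures using (IsStrictTotalOrder)
open import Relation.Binary.PropositionalEquality using (_≡_; _≢_)
open import Relation.Nullary using (¬_)

record Alphabet (a ℓ : Level) : Set (suc (a ⊔ ℓ)) where
  field
    Char  : Set a
    _≺_   : Rel Char ℓ
    isSTO : IsStrictTotalOrder _≡_ _≺_
    #     : Char
    #-min : ∀ c → c ≢ # → # ≺ c

module _ {a ℓ} (Sg : Alphabet a ℓ) where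
  open Alphabet Sg

  -- A node of a trie is identified with the string of edge labels on the
  -- path from the root to it (root-to-node order); the root is [].
  Node : Set a
  Node = List Char

  -- Edges: parent xs --c--> child xs ++ [ c ].  Distinct labels out of a
  -- node are automatic (distinct labels give distinct child nodes).
  record Trie : Set a where
    field
      nodes       : List Node
      nodes-uniq  : Unique nodes
      root∈       : [] ∈ nodes
      parent-closed : ∀ xs c → (xs ++ [ c ]) ∈ nodes → xs ∈ nodes
      no-#-edge   : ∀ xs c → (xs ++ [ c ]) ∈ nodes → c ≢ #

  open Trie public

  child : Char → Node → Node
  child c u = u ++ [ c ]

  _∈out_within_ : Char → Node → Trie → Set a
  c ∈out u within T = child c u ∈ nodes T

  -- λ(root) λ(u₁) ... λ(u): the label string of the root-to-node path,
  -- starting with # (the label of the root).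
  labels : Node → List Char
  labels u = # ∷ u

  _<colex_ : Node → Node → Set (a ⊔ ℓ)
  u <colex v = Lex-< _≡_ _≺_ (reverse (labels u)) (reverse (labels v))

  _<pred_within_ : Node → Node → Trie → Set (a ⊔ ℓ)
  u <pred v within T =
    u ∈ nodes T × v ∈ nodes T × u <colex v ×
    (∀ w → w ∈ nodes T → ¬ (u <colex w × w <colex v))

module Submission where

open import Data.List using (List; []; _∷_; [_]; reverse; initLast; _∷ʳ′_)
open import Data.List.Properties using (reverse-++)
open import Data.List.Membership.Propositional using (_∈_)
open import Data.List.Relation.Binary.Lex.Core using (this; next)
open import Data.List.Relation.Binary.Lex.Strict using (Lex-<; xs≮[])
open import Data.Empty using (⊥-elim)
open import Data.Product using (_×_; _,_)
open import Relation.Binary.PropositionalEquality using (_≡_; _≢_; refl; sym; subst₂)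
open import Relation.Binary.Structures using (IsStrictTotalOrder)
open import Relation.Nullary using (¬_)
open import Defs

-- Reversing a child's label string exposes the new edge label at the front,
-- so colex comparison of two children first compares their last edges and
-- only on a tie compares the parents.  A node strictly between c-children
-- must therefore itself be a c-child whose parent lies between theirs; it
-- cannot be the root, whose reversed labels [ # ] lie below every c-child.

module _ {a ℓ} (Sg : Alphabet a ℓ) where
  open Alphabet Sg
  private module STO = IsStrictTotalOrder isSTO

  _<lex_ : List Char → List Char → Set _
  _<lex_ = Lex-< _≡_ _≺_

  reverse-labels-child : ∀ c u → reverse (labels Sg (child Sg c u)) ≡ c ∷ reverse (labels Sg u)
  reverse-labels-child c u = reverse-++ (# ∷ u) [ c ]

  colex-child⇒lex : ∀ c d u w → _<colex_ Sg (child Sg c u) (child Sg d w) →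
                    (c ∷ reverse (labels Sg u)) <lex (d ∷ reverse (labels Sg w))
  colex-child⇒lex c d u w =
    subst₂ _<lex_ (reverse-labels-child c u) (reverse-labels-child d w)

  child-mono-colex : ∀ c u v → _<colex_ Sg u v → _<colex_ Sg (child Sg c u) (child Sg c v)
  child-mono-colex c u v u<v =
    subst₂ _<lex_ (sym (reverse-labels-child c u)) (sym (reverse-labels-child c v)) (next refl u<v)

  child≮colex-root : ∀ {c} u → c ≢ # → ¬ _<colex_ Sg (child Sg c u) []
  child≮colex-root {c} u c≢# cu<root
    with subst₂ _<lex_ (reverse-labels-child c u) refl cu<root
  ... | this c≺# = STO.asym c≺# (#-min c c≢#)
  ... | next _ <[] = xs≮[] <[]

  colex-between-children : ∀ c d u v w →
    _<colex_ Sg (child Sg c u) (child Sg d w) → _<colex_ Sg (child Sg d w) (child Sg c v) →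
    _<colex_ Sg u w × _<colex_ Sg w v
  colex-between-children c d u v w cu<dw dw<cv
    with colex-child⇒lex c d u w cu<dw | colex-child⇒lex d c w v dw<cv
  ... | this c≺d    | this d≺c    = ⊥-elim (STO.asym c≺d d≺c)
  ... | this c≺c    | next refl _ = ⊥-elim (STO.irrefl refl c≺c)
  ... | next refl _ | this c≺c    = ⊥-elim (STO.irrefl refl c≺c)
  ... | next _ u<w  | next _ w<v  = u<w , w<v

lemma7 : ∀ {a ℓ} (Sg : Alphabet a ℓ) (T : Trie Sg) (u v : Node Sg) (c : Alphabet.Char Sg) →
    _<pred_within_ Sg u v T →
    _∈out_within_ Sg c u T → _∈out_within_ Sg c v T →
    _<pred_within_ Sg (child Sg c u) (child Sg c v) T
lemma7 Sg T u v c (_ , _ , u<v , nothing-between) cu∈ cv∈ =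
  cu∈ , cv∈ , child-mono-colex Sg c u v u<v , nothing-between-children
  where
  nothing-between-children : ∀ w → w ∈ nodes T →
    ¬ (_<colex_ Sg (child Sg c u) w × _<colex_ Sg w (child Sg c v))
  nothing-between-children w w∈ (cu<w , w<cv) with initLast w
  ... | [] = child≮colex-root Sg u (no-#-edge T u c cu∈) cu<w
  ... | w′ ∷ʳ′ d =
    nothing-between w′ (parent-closed T w′ d w∈) (colex-between-children Sg c d u v w′ cu<w w<cv)
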